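{- Let $\mathfrak{X}\subseteq\mathcal{P}(\mathbb{N})$ be an arithmetically closed family of reals. If the poset $\mathfrak{X}/\mathrm{Fin}$ has the countable chain condition (c.c.c.), then $\mathfrak{X}$ is countable.
   Context: A family $\mathfrak{X}\subseteq\mathcal{P}(\mathbb{N})$ is arithmetically closed if whenever $A\in\mathfrak{X}$ and $B\subseteq\mathbb{N}$ is arithmetically definable from $A$, then $B\in\mathfrak{X}$. The poset $\mathfrak{X}/\mathrm{Fin}$ consists of the infinite sets in $\mathfrak{X}$, ordered by almost inclusion: $A\leq B$ iff $A\subseteq_{\mathrm{Fin}}B$, i.e. $A\setminus B$ is finite. -}

module Defs where

open import Data.Nat using (ℕ; zero; suc; _+_; _*_; _≥_)
open import Data.Bool using (Bool; true; false)
open import Data.Fin using (Fin)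
open import Data.Product using (Σ; ∃; _×_; _,_; proj₁)
open import Data.Empty using (⊥)
open import Data.Sum using (_⊎_)
open import Relation.Nullary using (¬_)
open import Relation.Binary.PropositionalEquality using (_≡_)
open import Function.Bundles using (_⇔_)

-- A real = a subset of ℕ, given by its characteristic function.
Real : Set
Real = ℕ → Bool

_≐_ : Real → Real → Set
A ≐ B = ∀ n → A n ≡ B n

Family : Set₁
Family = Real → Set

-- Second-order-parameter arithmetic: first-order arithmetic in the
-- language {0, S, +, ·, =} plus a unary predicate symbol for the
-- parameter set A.  Variables are de Bruijn indices (Fin n).

data Term (n : ℕ) : Set where
  var  : Fin n → Term n
  zer  : Term n
  sucT : Term n → Term n
  _⊕_  : Term n → Term n → Term n
  _⊗_  : Term n → Term n → Term n

data Formula (n : ℕ) : Set where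
  _≈ᶠ_ : Term n → Term n → Formula n
  mem  : Term n → Formula n
  ¬ᶠ_  : Formula n → Formula n
  _∧ᶠ_ : Formula n → Formula n → Formula n
  _∨ᶠ_ : Formula n → Formula n → Formula n
  _⇒ᶠ_ : Formula n → Formula n → Formula n
  ∀ᶠ   : Formula (suc n) → Formula n
  ∃ᶠ   : Formula (suc n) → Formula n

extend : ∀ {n} → (Fin n → ℕ) → ℕ → Fin (suc n) → ℕ
extend ρ x Fin.zero    = x
extend ρ x (Fin.suc i) = ρ i

evalT : ∀ {n} → (Fin n → ℕ) → Term n → ℕ
evalT ρ (var i)  = ρ i
evalT ρ zer      = zero
evalT ρ (sucT t) = suc (evalT ρ t)
evalT ρ (s ⊕ t)  = evalT ρ s + evalT ρ t
evalT ρ (s ⊗ t)  = evalT ρ s * evalT ρ t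

Sat : Real → ∀ {n} → Formula n → (Fin n → ℕ) → Set
Sat A (s ≈ᶠ t) ρ = evalT ρ s ≡ evalT ρ t
Sat A (mem t)  ρ = A (evalT ρ t) ≡ true
Sat A (¬ᶠ φ)   ρ = ¬ Sat A φ ρ
Sat A (φ ∧ᶠ ψ) ρ = Sat A φ ρ × Sat A ψ ρ
Sat A (φ ∨ᶠ ψ) ρ = Sat A φ ρ ⊎ Sat A ψ ρ
Sat A (φ ⇒ᶠ ψ) ρ = Sat A φ ρ → Sat A ψ ρ
Sat A (∀ᶠ φ)   ρ = (x : ℕ) → Sat A φ (extend ρ x)
Sat A (∃ᶠ φ)   ρ = Σ ℕ λ x → Sat A φ (extend ρ x)

ArithDefinableFrom : Real → Real → Set
ArithDefinableFrom A B =
  Σ (Formula 1) λ φ → ∀ k → (B k ≡ true) ⇔ Sat A φ (λ _ → k)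

ArithmeticallyClosed : Family → Set
ArithmeticallyClosed 𝔛 = ∀ A B → 𝔛 A → ArithDefinableFrom A B → 𝔛 B

Infinite : Real → Set
Infinite A = ∀ n → Σ ℕ λ m → m ≥ n × A m ≡ true

-- A ⊆_Fin B : A ∖ B is finite (bounded).
_⊆*_ : Real → Real → Set
A ⊆* B = Σ ℕ λ N → ∀ m → m ≥ N → A m ≡ true → B m ≡ true

-- Elements of 𝔛/Fin: infinite sets belonging to 𝔛.
InXFin : Family → Real → Set
InXFin 𝔛 A = 𝔛 A × Infinite A

Compatible : Family → Real → Real → Set
Compatible 𝔛 A B = Σ Real λ C → InXFin 𝔛 C × C ⊆* A × C ⊆* B

IsAntichain : Family → (Real → Set) → Set
IsAntichain 𝔛 𝒜 =
  (∀ A → 𝒜 A → InXFin 𝔛 A) ×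
  (∀ A B → 𝒜 A → 𝒜 B → ¬ (A ≐ B) → ¬ Compatible 𝔛 A B)

Countable : (Real → Set) → Set
Countable 𝒜 = Σ (Σ Real 𝒜 → ℕ) λ f →
  ∀ a b → f a ≡ f b → proj₁ a ≐ proj₁ b

CCC : Family → Set₁
CCC 𝔛 = ∀ (𝒜 : Real → Set) → IsAntichain 𝔛 𝒜 → Countable 𝒜

module Submission where

-- To every real A we attach an infinite set X A, arithmetical in A,
-- such that X A and X B are compatible in 𝔛/Fin only when A ≐ B.  The
-- elements of X A are the codes ⟨n, ⟨c, d⟩⟩ where (c, d) is the least
-- pair (in the order of the pairing function) coding the initial segment
-- A ↾ n in Gödel's β-function style: i < n lies in A iff 1 + d(1 + i)
-- divides c.  Every A ↾ n has such a code (Chinese remaindering with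
-- d = n!), so X A has one element at every level n and is infinite.  A
-- common infinite subset of X A and X B contains elements of arbitrarily
-- high level; as the code is determined by the element, A and B agree
-- below every level.  Hence A ↦ X A sends 𝔛 onto an antichain of 𝔛/Fin,
-- which the c.c.c. makes countable, and countability pulls back along the
-- (injective up to ≐) map A ↦ X A.

open import Defs
open import Data.Nat
open import Data.Nat.Properties
open import Data.Nat.Divisibility
open import Data.Nat.Coprimality using (Coprime; coprime-divisor)
import Data.Nat.Coprimality as Coprimality
open import Data.Nat.Induction using (<-rec)
open import Data.Nat.Tactic.RingSolver using (solve-∀)
open import Data.Fin using (#_) renaming (zero to fz; suc to fs)
open import Data.Product
open import Data.Sum using (inj₁; inj₂)
open import Data.Bool using (true; false; if_then_else_)
open import Data.Bool.Properties using (⇔→≡) renaming (_≟_ to _≟ᵇ_)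
open import Data.Empty using (⊥-elim)
open import Relation.Nullary
open import Relation.Nullary.Decidable using (map′; _×-dec_; _→-dec_; ¬?; does-⇔)
open import Relation.Binary.PropositionalEquality
open import Relation.Binary.Definitions using (tri<; tri≈; tri>)
open import Function using (_∘_)
open import Function.Bundles using (_⇔_; mk⇔; Equivalence)

pair : ℕ → ℕ → ℕ
pair x y = (x + y) * (x + y) + x

n≤n*n : ∀ n → n ≤ n * n
n≤n*n zero    = z≤n
n≤n*n (suc n) = m≤m*n (suc n) (suc n)

x≤pair : ∀ x y → x ≤ pair x y
x≤pair x y = m≤n+m x ((x + y) * (x + y))

y≤pair : ∀ x y → y ≤ pair x y
y≤pair x y = ≤-trans (m≤n+m y x) (≤-trans (n≤n*n (x + y)) (m≤m+n _ x))

pair-mono : ∀ {x x' y y'} → x ≤ x' → y ≤ y' → pair x y ≤ pair x' y'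
pair-mono x≤x' y≤y' =
  +-mono-≤ (*-mono-≤ (+-mono-≤ x≤x' y≤y') (+-mono-≤ x≤x' y≤y')) x≤x'

pair-<-sum : ∀ x y x' y' → x + y < x' + y' → pair x y < pair x' y'
pair-<-sum x y x' y' s<s' = begin-strict
  s * s + x            ≤⟨ +-monoʳ-≤ (s * s) (m≤m+n x y) ⟩
  s * s + s            <⟨ s≤s (m≤m+n (s * s + s) s) ⟩
  suc (s * s + s + s)  ≡⟨ square-suc s ⟨
  suc s * suc s        ≤⟨ *-mono-≤ s<s' s<s' ⟩
  s' * s'              ≤⟨ m≤m+n (s' * s') x' ⟩
  s' * s' + x'         ∎
  where
  open ≤-Reasoning
  s = x + y
  s' = x' + y'
  square-suc : ∀ s → suc s * suc s ≡ suc (s * s + s + s)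
  square-suc = solve-∀

pair-injective : ∀ {x y x' y'} → pair x y ≡ pair x' y' → x ≡ x' × y ≡ y'
pair-injective {x} {y} {x'} {y'} eq with <-cmp (x + y) (x' + y')
... | tri< lt _ _ = ⊥-elim (<⇒≢ (pair-<-sum x y x' y' lt) eq)
... | tri> _ _ gt = ⊥-elim (<⇒≢ (pair-<-sum x' y' x y gt) (sym eq))
... | tri≈ _ s≡s' _ = x≡x' , +-cancelˡ-≡ x y y' (trans s≡s' (cong (_+ y') (sym x≡x')))
  where
  x≡x' : x ≡ x'
  x≡x' = +-cancelˡ-≡ ((x' + y') * (x' + y')) x x'
           (trans (cong (λ s → s * s + x) (sym s≡s')) eq)

boundedΣ? : {P : ℕ → Set} → (∀ x → Dec (P x)) →
            (b : ℕ) → (∀ x → P x → x ≤ b) → Dec (Σ ℕ P)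
boundedΣ? P? b bounded = map′ (λ (x , _ , p) → x , p)
  (λ (x , p) → x , s≤s (bounded x p) , p) (anyUpTo? P? (suc b))

boundedΠ? : {P : ℕ → Set} → (∀ x → Dec (P x)) →
            (b : ℕ) → (∀ x → b < x → P x) → Dec (∀ x → P x)
boundedΠ? {P} P? b beyond = map′ everywhere (λ all _ → all _) (allUpTo? P? (suc b))
  where
  everywhere : (∀ {x} → x < suc b → P x) → ∀ x → P x
  everywhere upTo x with x ≤? b
  ... | yes x≤b = upTo (s≤s x≤b)
  ... | no  x≰b = beyond x (≰⇒> x≰b)

leastWitness : {P : ℕ → Set} → (∀ x → Dec (P x)) →
               ∀ x → P x → Σ ℕ λ w → P w × (∀ v → v < w → ¬ P v)
leastWitness {P} P? = <-rec _ search
  where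
  search : ∀ x → (∀ {y} → y < x → P y → Σ ℕ λ w → P w × (∀ v → v < w → ¬ P v)) →
           P x → Σ ℕ λ w → P w × (∀ v → v < w → ¬ P v)
  search x smaller p with anyUpTo? P? x
  ... | yes (y , y<x , py) = smaller y<x py
  ... | no  none           = x , p , λ v v<x pv → none (v , v<x , pv)

-- β-function coding of finite sets.

-- (c, d) codes the set {i | modulus d i ∣ c}.
modulus : ℕ → ℕ → ℕ
modulus d i = suc (d * suc i)

modulus-coprime : ∀ d i δ → δ ∣ d → Coprime (modulus d i) (modulus d (i + δ))
modulus-coprime d i δ δ∣d {g} (g∣Mᵢ , g∣Mᵢ₊δ) = ∣1⇒≡1 g∣1
  where
  -- (1 + i + δ)·Mᵢ = δ + (1 + i)·Mᵢ₊δ, so a common divisor g divides δ;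
  -- then g divides d(1 + i) = Mᵢ - 1 as well, hence 1.
  identity : ∀ d i δ → suc (i + δ) * suc (d * suc i) ≡ δ + suc i * suc (d * suc (i + δ))
  identity = solve-∀
  g∣rhs : g ∣ suc i * modulus d (i + δ) + δ
  g∣rhs = subst (g ∣_) (trans (identity d i δ) (+-comm δ _)) (∣-trans g∣Mᵢ (n∣m*n (suc (i + δ))))
  g∣δ : g ∣ δ
  g∣δ = ∣m+n∣m⇒∣n g∣rhs (∣-trans g∣Mᵢ₊δ (n∣m*n (suc i)))
  g∣1 : g ∣ 1
  g∣1 = ∣m+n∣m⇒∣n (subst (g ∣_) (+-comm 1 (d * suc i)) g∣Mᵢ)
                   (∣-trans (∣-trans g∣δ δ∣d) (m∣m*n (suc i)))

∣factorial : ∀ {t N} → 0 < t → t ≤ N → t ∣ N !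
∣factorial {suc t} _ t≤N = ∣-trans (m∣m*n (t !)) (m≤n⇒m!∣n! t≤N)

factorial-moduli-coprime< : ∀ {N i j} → i < j → j < N →
                            Coprime (modulus (N !) i) (modulus (N !) j)
factorial-moduli-coprime< {N} {i} {j} i<j j<N =
  subst (Coprime (modulus (N !) i) ∘ modulus (N !)) (m+[n∸m]≡n (<⇒≤ i<j))
    (modulus-coprime (N !) i (j ∸ i)
      (∣factorial (m<n⇒0<n∸m i<j) (≤-trans (m∸n≤m j i) (<⇒≤ j<N))))

factorial-moduli-coprime : ∀ {N i j} → i < N → j < N → i ≢ j →
                           Coprime (modulus (N !) i) (modulus (N !) j)
factorial-moduli-coprime {N} {i} {j} i<N j<N i≢j with <-cmp i j
... | tri< i<j _ _ = factorial-moduli-coprime< i<j j<N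
... | tri≈ _ i≡j _ = ⊥-elim (i≢j i≡j)
... | tri> _ _ j<i = Coprimality.sym (factorial-moduli-coprime< j<i i<N)

coprime-* : ∀ {m a b} → Coprime m a → Coprime m b → Coprime m (a * b)
coprime-* {m} {a} ma mb {g} (g∣m , g∣ab) = mb (g∣m , coprime-divisor ga g∣ab)
  where
  ga : Coprime g a
  ga (h∣g , h∣a) = ma (∣-trans h∣g g∣m , h∣a)

productCode : Real → ℕ → ℕ → ℕ
productCode A d zero    = 1
productCode A d (suc n) = if A n then modulus d n * productCode A d n else productCode A d n

modulus∣productCode : ∀ A d {n i} → i < n → A i ≡ true → modulus d i ∣ productCode A d n
modulus∣productCode A d {suc n} {i} i<1+n Ai≡true with A n in An | m<1+n⇒m<n∨m≡n i<1+n
... | true  | inj₁ i<n  = ∣-trans (modulus∣productCode A d i<n Ai≡true) (n∣m*n (modulus d n))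
... | false | inj₁ i<n  = modulus∣productCode A d i<n Ai≡true
... | true  | inj₂ refl = m∣m*n _
... | false | inj₂ refl with () ← trans (sym Ai≡true) An

coprime-productCode : ∀ A {N n i} → A i ≡ false → i < N → n ≤ N →
                      Coprime (modulus (N !) i) (productCode A (N !) n)
coprime-productCode A {N} {zero}  {i} _ _ _ (_ , g∣1) = ∣1⇒≡1 g∣1
coprime-productCode A {N} {suc n} {i} Ai≡false i<N n<N with A n in An
... | true  = coprime-* (factorial-moduli-coprime i<N n<N i≢n)
                       (coprime-productCode A Ai≡false i<N (<⇒≤ n<N))
  where
  i≢n : i ≢ n
  i≢n refl with () ← trans (sym Ai≡false) An
... | false = coprime-productCode A Ai≡false i<N (<⇒≤ n<N)

-- The set X A.  Below and Divides are < and ∣ written as the formula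
-- defining X A expresses them.

Below : ℕ → ℕ → Set
Below i n = Σ ℕ λ k → i + suc k ≡ n

_Divides_ : ℕ → ℕ → Set
m Divides n = Σ ℕ λ q → n ≡ q * m

Codes : Real → ℕ → ℕ → ℕ → Set
Codes A n c d = ∀ i → Below i n →
  (A i ≡ true → modulus d i Divides c) × (modulus d i Divides c → A i ≡ true)

LeastCode : Real → ℕ → ℕ → ℕ → Set
LeastCode A n c d = ∀ c' d' → Below (pair c' d') (pair c d) → ¬ Codes A n c' d'

-- m = ⟨n, ⟨c, d⟩⟩ with (c, d) the least code of A ↾ n; n is the level of m.
InX : Real → ℕ → Set
InX A m = Σ ℕ λ n → Σ ℕ λ c → Σ ℕ λ d →
  m ≡ pair n (pair c d) × (Codes A n c d × LeastCode A n c d)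

Below⇒< : ∀ {i n} → Below i n → i < n
Below⇒< {i} (k , refl) = subst (i <_) (sym (+-suc i k)) (s≤s (m≤m+n i k))

<⇒Below : ∀ {i n} → i < n → Below i n
<⇒Below {i} {n} i<n = n ∸ suc i , trans (+-suc i (n ∸ suc i)) (m+[n∸m]≡n i<n)

Divides⇔∣ : ∀ {m n} → m Divides n ⇔ m ∣ n
Divides⇔∣ = mk⇔ (λ (q , eq) → divides q eq) (λ (divides q eq) → q , eq)

canonicalCodes : ∀ A N → Codes A N (productCode A (N !) N) (N !)
canonicalCodes A N i below = into , outof
  where
  i<N : i < N
  i<N = Below⇒< below
  into : A i ≡ true → modulus (N !) i Divides productCode A (N !) N
  into Ai≡true = Equivalence.from Divides⇔∣ (modulus∣productCode A (N !) i<N Ai≡true)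
  1<modulus : 1 < modulus (N !) i
  1<modulus = s≤s (*-mono-≤ (1≤n! N) (s≤s z≤n))
  outof : modulus (N !) i Divides productCode A (N !) N → A i ≡ true
  outof mDividesC with A i in Ai
  ... | true  = refl
  ... | false = ⊥-elim (<⇒≢ 1<modulus (sym (coprime-productCode A Ai i<N ≤-refl
                          (∣-refl , Equivalence.to Divides⇔∣ mDividesC))))

canonical : Real → ℕ → ℕ
canonical A N = pair (productCode A (N !) N) (N !)

Below? : ∀ i n → Dec (Below i n)
Below? i n = map′ <⇒Below Below⇒< (i <? n)

Divides? : ∀ m n → Dec (m Divides n)
Divides? m n = map′ (Equivalence.from Divides⇔∣) (Equivalence.to Divides⇔∣) (m ∣? n)

Codes? : ∀ A n c d → Dec (Codes A n c d)
Codes? A n c d = boundedΠ? (λ i → Below? i n →-dec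
    ((A i ≟ᵇ true →-dec Divides? (modulus d i) c) ×-dec (Divides? (modulus d i) c →-dec A i ≟ᵇ true)))
  n (λ i n<i below → ⊥-elim (<⇒≱ (Below⇒< below) (<⇒≤ n<i)))

¬Below-pairˡ : ∀ {w x} y → w ≤ x → ¬ Below (pair x y) w
¬Below-pairˡ {w} {x} y w≤x below = <⇒≱ (Below⇒< below) (≤-trans w≤x (x≤pair x y))

¬Below-pairʳ : ∀ {w y} x → w ≤ y → ¬ Below (pair x y) w
¬Below-pairʳ {w} {y} x w≤y below = <⇒≱ (Below⇒< below) (≤-trans w≤y (y≤pair x y))

LeastCode? : ∀ A n c d → Dec (LeastCode A n c d)
LeastCode? A n c d = boundedΠ? (λ c' → boundedΠ? (λ d' →
      Below? (pair c' d') w →-dec ¬? (Codes? A n c' d'))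
    w (λ d' w<d' → ⊥-elim ∘ ¬Below-pairʳ c' (<⇒≤ w<d')))
  w (λ c' w<c' d' → ⊥-elim ∘ ¬Below-pairˡ d' (<⇒≤ w<c'))
  where
  w : ℕ
  w = pair c d

components≤ : ∀ {m} n c d → m ≡ pair n (pair c d) → n ≤ m × c ≤ m × d ≤ m
components≤ n c d refl =
  x≤pair n _ , ≤-trans (x≤pair c d) (y≤pair n _) , ≤-trans (y≤pair c d) (y≤pair n _)

InX? : ∀ A m → Dec (InX A m)
InX? A m = boundedΣ? level? m (λ n (c , d , eq , _) → proj₁ (components≤ n c d eq))
  where
  Entry : ℕ → ℕ → ℕ → Set
  Entry n c d = m ≡ pair n (pair c d) × (Codes A n c d × LeastCode A n c d)
  entry? : ∀ n c d → Dec (Entry n c d)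
  entry? n c d = (m ≟ pair n (pair c d)) ×-dec (Codes? A n c d ×-dec LeastCode? A n c d)
  level? : ∀ n → Dec (Σ ℕ λ c → Σ ℕ λ d → Entry n c d)
  level? n = boundedΣ? (λ c → boundedΣ? (entry? n c) m (λ d (eq , _) → proj₂ (proj₂ (components≤ n c d eq))))
               m (λ c (d , eq , _) → proj₁ (proj₂ (components≤ n c d eq)))

X : Real → Real
X A m = does (InX? A m)

does-true⇔ : ∀ {P : Set} (P? : Dec P) → does P? ≡ true ⇔ P
does-true⇔ (yes p)  = mk⇔ (λ _ → p) (λ _ → refl)
does-true⇔ (no ¬p) = mk⇔ (λ ()) (⊥-elim ∘ ¬p)

X-spec : ∀ A m → X A m ≡ true ⇔ InX A m
X-spec A m = does-true⇔ (InX? A m)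

Codes-cong : ∀ {A B} → A ≐ B → ∀ n c d → Codes A n c d → Codes B n c d
Codes-cong A≐B n c d codes i below =
  let (into , outof) = codes i below
  in into ∘ trans (A≐B i) , trans (sym (A≐B i)) ∘ outof

InX-cong : ∀ {A B m} → A ≐ B → InX A m → InX B m
InX-cong A≐B (n , c , d , eq , codes , least) =
  n , c , d , eq , Codes-cong A≐B n c d codes ,
  λ c' d' below → least c' d' below ∘ Codes-cong (sym ∘ A≐B) n c' d'

X-cong : ∀ {A B} → A ≐ B → X A ≐ X B
X-cong {A} {B} A≐B m =
  does-⇔ (mk⇔ (InX-cong A≐B) (InX-cong (sym ∘ A≐B))) (InX? A m) (InX? B m)

wkᵗ : ∀ {k} → Term k → Term (suc k)
wkᵗ (var i)  = var (fs i)
wkᵗ zer      = zer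
wkᵗ (sucT t) = sucT (wkᵗ t)
wkᵗ (s ⊕ t)  = wkᵗ s ⊕ wkᵗ t
wkᵗ (s ⊗ t)  = wkᵗ s ⊗ wkᵗ t

pairᵗ : ∀ {k} → Term k → Term k → Term k
pairᵗ x y = ((x ⊕ y) ⊗ (x ⊕ y)) ⊕ x

modulusᵗ : ∀ {k} → Term k → Term k → Term k
modulusᵗ d i = sucT (d ⊗ sucT i)

_<ᶠ_ : ∀ {k} → Term k → Term k → Formula k
s <ᶠ t = ∃ᶠ ((wkᵗ s ⊕ sucT (var fz)) ≈ᶠ wkᵗ t)

_∣ᶠ_ : ∀ {k} → Term k → Term k → Formula k
s ∣ᶠ t = ∃ᶠ (wkᵗ t ≈ᶠ (var fz ⊗ wkᵗ s))

_⇔ᶠ_ : ∀ {k} → Formula k → Formula k → Formula k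
φ ⇔ᶠ ψ = (φ ⇒ᶠ ψ) ∧ᶠ (ψ ⇒ᶠ φ)

-- ∀i. i < n ⇒ (i ∈ A ⇔ modulus d i ∣ c)
codesᶠ : ∀ {k} → Term k → Term k → Term k → Formula k
codesᶠ n c d = ∀ᶠ ((var fz <ᶠ wkᵗ n) ⇒ᶠ (mem (var fz) ⇔ᶠ (modulusᵗ (wkᵗ d) (var fz) ∣ᶠ wkᵗ c)))

-- ∃n c d. m = ⟨n, ⟨c, d⟩⟩ ∧ codes(n, c, d) ∧ ∀c' d'. ⟨c', d'⟩ < ⟨c, d⟩ ⇒ ¬ codes(n, c', d')
inXᶠ : Formula 1
inXᶠ = ∃ᶠ (∃ᶠ (∃ᶠ ((m ≈ᶠ pairᵗ n (pairᵗ c d)) ∧ᶠ (codesᶠ n c d ∧ᶠ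
  ∀ᶠ (∀ᶠ ((pairᵗ (var (# 1)) (var (# 0)) <ᶠ pairᵗ (wkᵗ (wkᵗ c)) (wkᵗ (wkᵗ d)))
          ⇒ᶠ (¬ᶠ codesᶠ (wkᵗ (wkᵗ n)) (var (# 1)) (var (# 0)))))))))
  where
  m n c d : Term 4
  m = var (# 3)
  n = var (# 2)
  c = var (# 1)
  d = var (# 0)

inXᶠ-defines : ∀ A m → Sat A inXᶠ (λ _ → m) ≡ InX A m
inXᶠ-defines A m = refl

X-definable : ∀ A → ArithDefinableFrom A (X A)
X-definable A = inXᶠ , λ m → subst (X A m ≡ true ⇔_) (sym (inXᶠ-defines A m)) (X-spec A m)

-- X A has an element at every level, so it is infinite.

HasCode : Real → ℕ → ℕ → Set
HasCode A n w = Σ ℕ λ c → Σ ℕ λ d → pair c d ≡ w × Codes A n c d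

HasCode? : ∀ A n w → Dec (HasCode A n w)
HasCode? A n w =
  boundedΣ? (λ c → boundedΣ? (λ d → (pair c d ≟ w) ×-dec Codes? A n c d)
      w (λ d (eq , _) → subst (d ≤_) eq (y≤pair c d)))
    w (λ c (d , eq , _) → subst (c ≤_) eq (x≤pair c d))

-- The least code of A ↾ n, which exists because the canonical code is
-- one, gives the element of X A at level n.
levelElement : ∀ A n → Σ ℕ λ m → n ≤ m × InX A m
levelElement A n with leastWitness (HasCode? A n) (canonical A n) (_ , _ , refl , canonicalCodes A n)
... | _ , (c , d , refl , codes) , smallest =
  pair n (pair c d) , x≤pair n _ ,
  n , c , d , refl , codes ,
  λ c' d' below codes' → smallest (pair c' d') (Below⇒< below) (c' , d' , refl , codes')

X-infinite : ∀ A → Infinite (X A)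
X-infinite A N =
  let (m , N≤m , inX) = levelElement A N in m , N≤m , Equivalence.from (X-spec A m) inX

-- Elements of X A of level ≤ k are bounded, so large elements have large level.

leastCode≤canonical : ∀ {A n c d} → LeastCode A n c d → pair c d ≤ canonical A n
leastCode≤canonical {A} {n} least =
  ≮⇒≥ (λ canonical<cd → least _ _ (<⇒Below canonical<cd) (canonicalCodes A n))

codeBound : Real → ℕ → ℕ
codeBound A zero    = canonical A zero
codeBound A (suc k) = canonical A (suc k) + codeBound A k

canonical≤codeBound : ∀ A {n k} → n ≤ k → canonical A n ≤ codeBound A k
canonical≤codeBound A {n} {zero}  z≤n = ≤-refl
canonical≤codeBound A {n} {suc k} n≤1+k with m≤n⇒m<n∨m≡n n≤1+k
... | inj₁ n<1+k = ≤-trans (canonical≤codeBound A {k = k} (<⇒≤pred n<1+k)) (m≤n+m _ _)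
... | inj₂ refl  = m≤m+n _ _

level-large : ∀ {A m k} (inX : InX A m) → pair k (codeBound A k) < m → k < proj₁ inX
level-large {A} {k = k} (n , c , d , refl , _ , least) bound with k <? n
... | yes k<n = k<n
... | no  k≮n = ⊥-elim (<⇒≱ bound (pair-mono n≤k
                  (≤-trans (leastCode≤canonical {A} {n} {c} {d} least) (canonical≤codeBound A n≤k))))
  where
  n≤k : n ≤ k
  n≤k = ≮⇒≥ k≮n

InX-agree : ∀ {A B m} (inX : InX A m) → InX B m → ∀ {k} → k < proj₁ inX → A k ≡ B k
InX-agree (n , c , d , refl , codesA , _) (n' , c' , d' , eq , codesB , _) {k} k<n
  with pair-injective {n} {pair c d} {n'} {pair c' d'} eq
... | refl , eq' with pair-injective {c} {d} {c'} {d'} eq'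
... | refl , refl = ⇔→≡ (mk⇔ (proj₂ (codesB k below) ∘ proj₁ (codesA k below))
                             (proj₂ (codesA k below) ∘ proj₁ (codesB k below)))
  where
  below : Below k n
  below = <⇒Below k<n

-- An infinite set almost contained in X A and X B has elements of every
-- level, so A and B agree everywhere.
compatible⇒≐ : ∀ {𝔛} A B → Compatible 𝔛 (X A) (X B) → A ≐ B
compatible⇒≐ A B (C , (_ , C-infinite) , (N₁ , C⊆XA) , (N₂ , C⊆XB)) k =
  agreeAt (C-infinite (N₁ ⊔ N₂ ⊔ suc bound))
  where
  bound : ℕ
  bound = pair k (codeBound A k)
  -- Any element of C beyond N₁, N₂ and bound lies in X A ∩ X B at level > k.
  agreeAt : (Σ ℕ λ m → m ≥ N₁ ⊔ N₂ ⊔ suc bound × C m ≡ true) → A k ≡ B k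
  agreeAt (m , m≥ , Cm) = InX-agree {A} {B} {m} inA inB {k} (level-large {A} {m} {k} inA bound<m)
    where
    N≤m : N₁ ⊔ N₂ ≤ m
    N≤m = ≤-trans (m≤m⊔n (N₁ ⊔ N₂) (suc bound)) m≥
    bound<m : bound < m
    bound<m = ≤-trans (m≤n⊔m (N₁ ⊔ N₂) (suc bound)) m≥
    inA : InX A m
    inA = Equivalence.to (X-spec A m) (C⊆XA m (≤-trans (m≤m⊔n N₁ N₂) N≤m) Cm)
    inB : InX B m
    inB = Equivalence.to (X-spec B m) (C⊆XB m (≤-trans (m≤n⊔m N₁ N₂) N≤m) Cm)

≐⇒compatible : ∀ {𝔛 Y Z} → InXFin 𝔛 Y → Y ≐ Z → Compatible 𝔛 Y Z
≐⇒compatible {Y = Y} inY Y≐Z =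
  Y , inY , (0 , λ _ _ Ym → Ym) , (0 , λ m _ Ym → trans (sym (Y≐Z m)) Ym)

X-inXFin : ∀ {𝔛 A} → ArithmeticallyClosed 𝔛 → 𝔛 A → InXFin 𝔛 (X A)
X-inXFin {A = A} closed A∈𝔛 = closed A (X A) A∈𝔛 (X-definable A) , X-infinite A

theorem3p1 : (𝔛 : Family) → ArithmeticallyClosed 𝔛 → CCC 𝔛 → Countable 𝔛
theorem3p1 𝔛 closed ccc = code ∘ toImage , injective
  where
  image : Real → Set
  image Y = Σ Real λ A → 𝔛 A × Y ≡ X A

  antichain : IsAntichain 𝔛 image
  antichain = (λ { _ (_ , A∈𝔛 , refl) → X-inXFin closed A∈𝔛 })
            , (λ { _ _ (A , _ , refl) (B , _ , refl) XA≠XB compatible →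
                   XA≠XB (X-cong (compatible⇒≐ {𝔛} A B compatible)) })

  code : Σ Real image → ℕ
  code = proj₁ (ccc image antichain)
  code-injective : ∀ a b → code a ≡ code b → proj₁ a ≐ proj₁ b
  code-injective = proj₂ (ccc image antichain)

  toImage : Σ Real 𝔛 → Σ Real image
  toImage (A , A∈𝔛) = X A , A , A∈𝔛 , refl

  injective : ∀ a b → code (toImage a) ≡ code (toImage b) → proj₁ a ≐ proj₁ b
  injective (A , A∈𝔛) (B , _) eq =
    compatible⇒≐ {𝔛} A B (≐⇒compatible (X-inXFin closed A∈𝔛) (code-injective _ _ eq))
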